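{- For every digraph $D$ with at least one vertex, $\mathrm{a}(D)<\frac{\mathrm{v}(D)\left(\mathrm{v}(D)+\min\{c(D),2\,\mathrm{dtw}(D)\}\right)}{2}$.
   Context: Digraphs are finite, have no loops and no parallel arcs (antiparallel arcs allowed). $\mathrm{v}(D),\mathrm{a}(D)$ are the numbers of vertices and arcs. $c(D)$ is the maximum $k$ such that there are directed cycles $C_1,\ldots,C_k$ in $D$ all containing a common vertex $v$ with $V(C_i)\setminus\{v\}$ pairwise disjoint. Directed tree-width (Johnson, Robertson, Seymour, Thomas): for $X\subseteq V(D)$, a set $Z\subseteq V(D)\setminus X$ is $X$-normal if there is no directed walk in $D-X$ whose first and last vertices lie in $Z$ and which contains a vertex not in $Z$. An arborescence is a directed tree $R$ with a root $r_0$ such that every vertex is reachable from $r_0$. An arboreal decomposition of $D$ is a triple $(R,(X_e)_{e\in A(R)},(W_t)_{t\in V(R)})$ where $R$ is an arborescence, the $W_t$ are nonempty, pairwise disjoint sets with union $V(D)$, each $X_e\subseteq V(D)$, and for every arc $e=(s,t)$ of $R$ the set $\bigcup\{W_u: u\text{ reachable from }t\text{ in }R\}$ is $X_e$-normal. Its width is $\max_{t}\left|W_t\cup\bigcup_{e\text{ incident with }t}X_e\right|-1$; $\mathrm{dtw}(D)$ is the minimum width over all arboreal decompositions. -}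

module Defs where

open import Data.Nat using (ℕ; zero; suc; _+_; _*_; _≤_; _⊓_)
open import Data.Fin using (Fin)
open import Data.Fin.Subset.Properties using (_∈?_)
open import Data.Fin.Subset using (Subset; _∈_; _∉_; _∪_; ⊥; ⋃; ∣_∣; Nonempty)
open import Data.List using (List; []; _∷_; map; allFin)
open import Data.Nat.ListAction using (sum)
open import Data.List.NonEmpty using (List⁺; toList; head; last)
import Data.List.NonEmpty as L⁺
open import Data.List.Relation.Unary.All using (All)
open import Data.List.Relation.Unary.Linked using (Linked)
open import Data.List.Relation.Unary.Unique.Propositional using (Unique)
open import Data.Product using (Σ; ∃; _×_; _,_)
open import Data.Bool using (if_then_else_)
open import Relation.Binary.PropositionalEquality using (_≡_; _≢_)
open import Relation.Nullary using (¬_; does)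

-- Digraphs on vertex set Fin n: out-neighbourhoods given as subsets.
-- No loops; no parallel arcs (automatic, arcs are pairs); antiparallel
-- arcs allowed.

record Digraph (n : ℕ) : Set where
  field
    out      : Fin n → Subset n
    loopless : ∀ i → i ∉ out i

open Digraph public

Arc : ∀ {n} → Digraph n → Fin n → Fin n → Set
Arc D i j = j ∈ out D i

-- v(D) = n ; a(D) = number of arcs
arcs : ∀ {n} → Digraph n → ℕ
arcs {n} D = sum (map (λ i → ∣ out D i ∣) (allFin n))

data Walk {n} (D : Digraph n) : Fin n → Fin n → Set where
  stop : ∀ {x} → Walk D x x
  step : ∀ {x y z} → Arc D x y → Walk D y z → Walk D x z

verts : ∀ {n} {D : Digraph n} {x y} → Walk D x y → List (Fin n)
verts {x = x} stop       = x ∷ []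
verts {x = x} (step _ w) = x ∷ verts w

Reachable : ∀ {n} → Digraph n → Fin n → Fin n → Set
Reachable D x y = Walk D x y

record Cycle {n} (D : Digraph n) : Set where
  field
    cverts  : List⁺ (Fin n)
    long    : 2 ≤ L⁺.length cverts
    linked  : Linked (Arc D) (toList cverts)
    closing : Arc D (last cverts) (head cverts)
    unique  : Unique (toList cverts)

open Cycle public

_∈C_ : ∀ {n} {D : Digraph n} → Fin n → Cycle D → Set
x ∈C C = Data.List.Membership.Propositional._∈_ x (toList (cverts C))
  where import Data.List.Membership.Propositional

CFamily : ∀ {n} → Digraph n → ℕ → Set
CFamily {n} D k =
  Σ (Fin n) λ v → Σ (Fin k → Cycle D) λ C →
    (∀ i → v ∈C C i) ×
    (∀ i j x → x ≢ v → x ∈C C i → x ∈C C j → i ≡ j)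

-- c(D) = k : k is the maximum size of such a family
IsC : ∀ {n} → Digraph n → ℕ → Set
IsC D k = CFamily D k × (∀ m → CFamily D m → m ≤ k)

Normal : ∀ {n} (D : Digraph n) → Subset n → (Fin n → Set) → Set
Normal {n} D X Z =
  (∀ z → Z z → z ∉ X) ×
  (∀ x y (w : Walk D x y) → All (_∉ X) (verts w) → Z x → Z y →
     All Z (verts w))

-- Arborescences: a digraph R on Fin m (a directed tree, i.e. its
-- underlying graph is a tree: connected with m - 1 edges) with a root
-- from which every vertex is reachable.

IsArborescence : ∀ {m} → Digraph m → Fin m → Set
IsArborescence {m} R r₀ = (∀ t → Reachable R r₀ t) × (suc (arcs R) ≡ m)

-- Arboreal decompositions.  X s t is X_e for the arc e = (s,t) of R
-- (values at non-arcs are irrelevant).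

record ArborealDecomposition {n} (D : Digraph n) : Set₁ where
  field
    m      : ℕ
    R      : Digraph m
    r₀     : Fin m
    arbo   : IsArborescence R r₀
    X      : Fin m → Fin m → Subset n
    W      : Fin m → Subset n
    W-ne   : ∀ t → Nonempty (W t)
    W-disj : ∀ s t x → x ∈ W s → x ∈ W t → s ≡ t
    W-cov  : ∀ x → ∃ λ t → x ∈ W t
    normal : ∀ s t → Arc R s t →
               Normal D (X s t) (λ x → ∃ λ u → Reachable R t u × x ∈ W u)

open ArborealDecomposition public

-- the bag W_t ∪ ⋃ { X_e : e incident with t }
bag : ∀ {n} {D : Digraph n} (T : ArborealDecomposition D) → Fin (m T) → Subset n
bag T t = W T t ∪ ⋃ (map (λ s →
    (if does (t ∈? out (R T) s) then X T s t else ⊥) ∪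
    (if does (s ∈? out (R T) t) then X T t s else ⊥)) (allFin (m T)))

WidthAtMost : ∀ {n} {D : Digraph n} → ArborealDecomposition D → ℕ → Set
WidthAtMost T w = ∀ t → ∣ bag T t ∣ ≤ suc w

HasDecOfWidthAtMost : ∀ {n} → Digraph n → ℕ → Set₁
HasDecOfWidthAtMost D w = Σ (ArborealDecomposition D) λ T → WidthAtMost T w

-- dtw(D) = w : w is the minimum width of an arboreal decomposition
IsDtw : ∀ {n} → Digraph n → ℕ → Set₁
IsDtw D w = HasDecOfWidthAtMost D w × (∀ w' → HasDecOfWidthAtMost D w' → w ≤ w')

-- Let d(u) be the number of vertices v with both arcs u → v and v → u.  Counting
-- ordered pairs, 2 a(D) = Σ_{u,v} ([u → v] + [v → u]), where each term is at most
-- 1 + [u ↔ v] and vanishes on the diagonal, so 2 a(D) < v(D)² + Σ_u d(u).  The 2-cycles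
-- through u form a family showing d(u) ≤ c(D).  In an arboreal decomposition of width w
-- let h(u) be the node whose W-set contains u.  For a digon u ↔ v with v outside the bag
-- of h(u), normality of the part of R below the arc entering h(u) puts h(v) below h(u);
-- as reachability in an arborescence is antisymmetric, v lies in the bag of h(u) or u in
-- the bag of h(v).  A bag of h(u) has at most w vertices besides u, so Σ_u d(u) ≤ 2 v(D) w.

module Submission where

open import Defs
open import Data.Nat using (ℕ; zero; suc; _+_; _*_; _<_; _≤_; _⊓_; z≤n; s≤s)
open import Data.Nat.Properties
  using ( +-0-commutativeMonoid; ≤-refl; ≤-reflexive; ≤-trans; <⇒≤; <⇒≱; ≮⇒≥; ≤-pred
        ; m≤m+n; m≤n+m; +-comm; +-identityʳ; *-identityʳ; *-zeroʳ
        ; +-mono-≤; +-monoʳ-≤; +-mono-<-≤; +-mono-≤-<; *-distribˡ-+; *-distribˡ-⊓; ⊓-glb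
        ; module ≤-Reasoning )
open import Algebra.Properties.CommutativeMonoid.Sum +-0-commutativeMonoid
  using (sum; sum-syntax; ∑-comm; ∑-distrib-+; sum-cong-≗)
open import Data.Fin using (Fin; zero; suc; _≟_)
open import Data.Fin.Properties using (suc-injective)
open import Data.Fin.Subset using (Subset; inside; outside; ∣_∣; _∈_; _∉_; _-_; ⋃)
import Data.Fin.Subset as Subset
open import Data.Fin.Subset.Properties using (_∈?_; x∈p∪q⁺; x∈p∧x≢y⇒x∈p-y; x∈p⇒∣p-x∣<∣p∣)
open import Data.List using (List; []; _∷_; map; allFin; tabulate)
open import Data.List.Properties using (map-tabulate)
import Data.Nat.ListAction as List
open import Data.List.Membership.Propositional using () renaming (_∈_ to _∈ˡ_; _∉_ to _∉ˡ_)
import Data.List.Membership.DecPropositional as DecMembership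
open import Data.List.Membership.Propositional.Properties using (∈-allFin)
open import Data.List.Relation.Unary.Any using (here; there)
open import Data.List.Relation.Unary.All as All using ([]; _∷_)
import Data.List.Relation.Unary.AllPairs as AllPairs
import Data.List.Relation.Unary.Linked as Linked
import Data.List.NonEmpty as List⁺
open import Data.Vec using ([]; _∷_)
open import Data.Bool using (if_then_else_)
open import Data.Product using (Σ; ∃; ∃₂; _×_; _,_; proj₁; proj₂)
open import Data.Sum using (_⊎_; inj₁; inj₂)
open import Data.Empty using (⊥; ⊥-elim)
open import Relation.Nullary using (Dec; does; yes; no; ¬_; _×-dec_)
open import Relation.Unary using (Pred; Decidable)
open import Relation.Binary.PropositionalEquality
  using (_≡_; _≢_; refl; sym; trans; cong; cong₂; subst; module ≡-Reasoning)
open import Function using (_∘_)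
open import Function.Definitions using (Injective)

χ : ∀ {p} {P : Set p} → Dec P → ℕ
χ d = if does d then 1 else 0

χ-yes : ∀ {p} {P : Set p} (d : Dec P) → P → χ d ≡ 1
χ-yes (yes _) _  = refl
χ-yes (no ¬p) p  = ⊥-elim (¬p p)

χ-no : ∀ {p} {P : Set p} (d : Dec P) → ¬ P → χ d ≡ 0
χ-no (yes p) ¬p = ⊥-elim (¬p p)
χ-no (no _)  _  = refl

χ-≤ : ∀ {p} {P : Set p} (d : Dec P) {n} → (P → 1 ≤ n) → χ d ≤ n
χ-≤ (yes p) 1≤n = 1≤n p
χ-≤ (no _)  _   = z≤n

sum-const : ∀ n c → ∑[ i < n ] c ≡ n * c
sum-const zero    c = refl
sum-const (suc n) c = cong (c +_) (sum-const n c)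

sum-mono-≤ : ∀ {n} {f g : Fin n → ℕ} → (∀ i → f i ≤ g i) → sum f ≤ sum g
sum-mono-≤ {zero}  f≤g = z≤n
sum-mono-≤ {suc n} f≤g = +-mono-≤ (f≤g zero) (sum-mono-≤ (f≤g ∘ suc))

sum-mono-< : ∀ {n} {f g : Fin n → ℕ} → (∀ i → f i ≤ g i) → ∀ i → f i < g i →
             sum f < sum g
sum-mono-< f≤g zero    fi<gi = +-mono-<-≤ fi<gi (sum-mono-≤ (f≤g ∘ suc))
sum-mono-< f≤g (suc i) fi<gi = +-mono-≤-< (f≤g zero) (sum-mono-< (f≤g ∘ suc) i fi<gi)

term≤sum : ∀ {n} (f : Fin n → ℕ) i → f i ≤ sum f
term≤sum f zero    = m≤m+n (f zero) _
term≤sum f (suc i) = ≤-trans (term≤sum (f ∘ suc) i) (m≤n+m _ (f zero))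

two-terms≤sum : ∀ {n} (f : Fin n → ℕ) {i j} → i ≢ j → f i + f j ≤ sum f
two-terms≤sum f {zero}  {zero}  0≢0 = ⊥-elim (0≢0 refl)
two-terms≤sum f {zero}  {suc j} _   = +-monoʳ-≤ (f zero) (term≤sum (f ∘ suc) j)
two-terms≤sum f {suc i} {zero}  i≢0 =
  subst (_≤ sum f) (+-comm (f zero) (f (suc i))) (two-terms≤sum f (i≢0 ∘ sym))
two-terms≤sum f {suc i} {suc j} i≢j =
  ≤-trans (two-terms≤sum (f ∘ suc) (i≢j ∘ cong suc)) (m≤n+m _ (f zero))

all≥1∧sum≤n⇒≤1 : ∀ {n} {f : Fin n → ℕ} → (∀ i → 1 ≤ f i) → sum f ≤ n → ∀ i → f i ≤ 1
all≥1∧sum≤n⇒≤1 {n} {f} 1≤f ∑f≤n i = ≮⇒≥ λ 1<fi → <⇒≱ (sum-mono-< 1≤f i 1<fi) (begin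
  sum f         ≤⟨ ∑f≤n ⟩
  n             ≡⟨ *-identityʳ n ⟨
  n * 1         ≡⟨ sum-const n 1 ⟨
  ∑[ i < n ] 1  ∎)
  where open ≤-Reasoning

sum-χ-≟ : ∀ {n} (i : Fin n) → ∑[ j < n ] χ (j ≟ i) ≡ 1
sum-χ-≟ {suc n} zero    = cong suc (trans (sum-const n 0) (*-zeroʳ n))
sum-χ-≟ {suc n} (suc i) = sum-χ-≟ i

listSum≡sum : ∀ {n} (f : Fin n → ℕ) → List.sum (map f (allFin n)) ≡ sum f
listSum≡sum f = trans (cong List.sum (map-tabulate (λ i → i) f)) (listSum-tabulate f)
  where
  listSum-tabulate : ∀ {n} (f : Fin n → ℕ) → List.sum (tabulate f) ≡ sum f
  listSum-tabulate {zero}  f = refl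
  listSum-tabulate {suc n} f = cong (f zero +_) (listSum-tabulate (f ∘ suc))

∣p∣≡sum : ∀ {n} (p : Subset n) → ∣ p ∣ ≡ ∑[ j < n ] χ (j ∈? p)
∣p∣≡sum []            = refl
∣p∣≡sum (inside ∷ p)  = cong suc (∣p∣≡sum p)
∣p∣≡sum (outside ∷ p) = ∣p∣≡sum p

enumerate : ∀ {n p} {P : Pred (Fin n) p} (P? : Decidable P) →
            Σ (Fin (∑[ i < n ] χ (P? i)) → Fin n) λ e → (∀ i → P (e i)) × Injective _≡_ _≡_ e
enumerate {zero}  P? = (λ ()) , (λ ()) , λ {}
enumerate {suc n} {P = P} P? with P? zero | enumerate (P? ∘ suc)
... | no  _  | e , Pe , e-inj = suc ∘ e , Pe , e-inj ∘ suc-injective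
... | yes P0 | e , Pe , e-inj = e′ , Pe′ , e′-inj
  where
  e′ : Fin (suc (∑[ i < n ] χ (P? (suc i)))) → Fin (suc n)
  e′ zero    = zero
  e′ (suc i) = suc (e i)
  Pe′ : ∀ i → P (e′ i)
  Pe′ zero    = P0
  Pe′ (suc i) = Pe i
  e′-inj : Injective _≡_ _≡_ e′
  e′-inj {zero}  {zero}  _  = refl
  e′-inj {suc i} {suc j} eq = cong suc (e-inj (suc-injective eq))

module _ {n} {D : Digraph n} where

  _++ʷ_ : ∀ {x y z} → Walk D x y → Walk D y z → Walk D x z
  stop     ++ʷ w = w
  step e v ++ʷ w = step e (v ++ʷ w)

  end∈verts : ∀ {x y} (w : Walk D x y) → y ∈ˡ verts w
  end∈verts stop       = here refl
  end∈verts (step _ w) = there (end∈verts w)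

  predecessor-on-walk : ∀ {x y z} (w : Walk D x y) → z ∈ˡ verts w →
                        z ≡ x ⊎ ∃ λ p → p ∈ˡ verts w × Arc D p z
  predecessor-on-walk stop           (here z≡x)  = inj₁ z≡x
  predecessor-on-walk (step _ _)     (here z≡x)  = inj₁ z≡x
  predecessor-on-walk {x} (step e w) (there z∈w) with predecessor-on-walk w z∈w
  ... | inj₁ refl            = inj₂ (x , here refl , e)
  ... | inj₂ (p , p∈w , p→z) = inj₂ (p , there p∈w , p→z)

  incoming-arc : ∀ {x y} → Walk D x y → x ≢ y → ∃ λ s → Arc D s y
  incoming-arc w x≢y with predecessor-on-walk w (end∈verts w)
  ... | inj₁ y≡x           = ⊥-elim (x≢y (sym y≡x))
  ... | inj₂ (p , _ , p→y) = p , p→y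

  walk-enters : ∀ (V : List (Fin n)) {x y} → Walk D x y → x ∉ˡ V → y ∈ˡ V →
                ∃₂ λ p q → Arc D p q × p ∉ˡ V × q ∈ˡ V
  walk-enters V stop x∉V x∈V = ⊥-elim (x∉V x∈V)
  walk-enters V {x} (step {y = z} x→z w) x∉V y∈V with DecMembership._∈?_ _≟_ z V
  ... | yes z∈V = x , z , x→z , x∉V , z∈V
  ... | no  z∉V = walk-enters V w z∉V y∈V

arc? : ∀ {n} (D : Digraph n) i j → Dec (Arc D i j)
arc? D i j = j ∈? out D i

adjacency : ∀ {n} → Digraph n → Fin n → Fin n → ℕ
adjacency D i j = χ (arc? D i j)

arcs≡sum-adjacency : ∀ {n} (D : Digraph n) → arcs D ≡ ∑[ i < n ] ∑[ j < n ] adjacency D i j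
arcs≡sum-adjacency D = trans (listSum≡sum (λ i → ∣ out D i ∣)) (sum-cong-≗ (λ i → ∣p∣≡sum (out D i)))

indegree : ∀ {n} → Digraph n → Fin n → ℕ
indegree {n} D t = ∑[ s < n ] adjacency D s t

arcs≡sum-indegree : ∀ {n} (D : Digraph n) → arcs D ≡ ∑[ t < n ] indegree D t
arcs≡sum-indegree D = trans (arcs≡sum-adjacency D) (∑-comm (adjacency D))

arc⇒1≤indegree : ∀ {n} (D : Digraph n) {s t} → Arc D s t → 1 ≤ indegree D t
arc⇒1≤indegree D {s} {t} s→t =
  subst (_≤ indegree D t) (χ-yes (arc? D s t) s→t) (term≤sum (λ s → adjacency D s t) s)

two-arcs⇒2≤indegree : ∀ {n} (D : Digraph n) {s₁ s₂ t} → Arc D s₁ t → Arc D s₂ t →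
                      s₁ ≢ s₂ → 2 ≤ indegree D t
two-arcs⇒2≤indegree D {s₁} {s₂} {t} s₁→t s₂→t s₁≢s₂ =
  subst (_≤ indegree D t) (cong₂ _+_ (χ-yes (arc? D s₁ t) s₁→t) (χ-yes (arc? D s₂ t) s₂→t))
        (two-terms≤sum (λ s → adjacency D s t) s₁≢s₂)

module Arborescence {m} (R : Digraph m) (r₀ : Fin m) (arbo : IsArborescence R r₀) where

  private
    reach : ∀ t → Walk R r₀ t
    reach = proj₁ arbo

  indegree+root≤1 : ∀ t → indegree R t + χ (t ≟ r₀) ≤ 1
  indegree+root≤1 = all≥1∧sum≤n⇒≤1 1≤indegree+root (≤-reflexive ∑≡m)
    where
    -- R has m − 1 arcs and every node other than the root has an in-arc.
    1≤indegree+root : ∀ t → 1 ≤ indegree R t + χ (t ≟ r₀)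
    1≤indegree+root t with t ≟ r₀
    ... | yes _   = m≤n+m 1 (indegree R t)
    ... | no  t≢r = ≤-trans (arc⇒1≤indegree R (proj₂ (incoming-arc (reach t) (t≢r ∘ sym))))
                            (m≤m+n _ 0)
    ∑≡m : ∑[ t < m ] (indegree R t + χ (t ≟ r₀)) ≡ m
    ∑≡m = begin
      ∑[ t < m ] (indegree R t + χ (t ≟ r₀))         ≡⟨ ∑-distrib-+ (indegree R) (λ t → χ (t ≟ r₀)) ⟩
      ∑[ t < m ] indegree R t + ∑[ t < m ] χ (t ≟ r₀) ≡⟨ cong₂ _+_ (sym (arcs≡sum-indegree R)) (sum-χ-≟ r₀) ⟩
      arcs R + 1                                      ≡⟨ +-comm (arcs R) 1 ⟩
      suc (arcs R)                                    ≡⟨ proj₂ arbo ⟩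
      m                                               ∎
      where open ≡-Reasoning

  root-has-no-parent : ∀ {s} → ¬ Arc R s r₀
  root-has-no-parent s→r₀ =
    <⇒≱ (+-mono-≤ (arc⇒1≤indegree R s→r₀) (≤-reflexive (sym (χ-yes (r₀ ≟ r₀) refl))))
        (indegree+root≤1 r₀)

  parent-unique : ∀ {s₁ s₂ t} → Arc R s₁ t → Arc R s₂ t → s₁ ≡ s₂
  parent-unique {s₁} {s₂} {t} s₁→t s₂→t with s₁ ≟ s₂
  ... | yes s₁≡s₂ = s₁≡s₂
  ... | no  s₁≢s₂ = ⊥-elim (<⇒≱ (two-arcs⇒2≤indegree R s₁→t s₂→t s₁≢s₂)
                                (≤-trans (m≤m+n _ _) (indegree+root≤1 t)))

  -- Every vertex of the closed walk has its parent on the walk, so the walk from the root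
  -- enters it through an arc whose head has a second parent.
  no-closed-walk : ∀ {a b} → Arc R a b → Walk R b a → ⊥
  no-closed-walk {a} a→b w =
    let (p , q , p→q , p∉w , q∈w) = walk-enters (verts w) (reach a) r₀∉w (end∈verts w)
        (p′ , p′∈w , p′→q)        = parent-on-w q q∈w
    in p∉w (subst (_∈ˡ verts w) (parent-unique p′→q p→q) p′∈w)
    where
    parent-on-w : ∀ z → z ∈ˡ verts w → ∃ λ p → p ∈ˡ verts w × Arc R p z
    parent-on-w z z∈w with predecessor-on-walk w z∈w
    ... | inj₁ refl = a , end∈verts w , a→b
    ... | inj₂ p    = p
    r₀∉w : r₀ ∉ˡ verts w
    r₀∉w r₀∈w = root-has-no-parent (proj₂ (proj₂ (parent-on-w r₀ r₀∈w)))

  reachable-antisym : ∀ {a b} → Walk R a b → Walk R b a → a ≡ b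
  reachable-antisym stop         _    = refl
  reachable-antisym (step a→x w) w′ = ⊥-elim (no-closed-walk a→x (w ++ʷ w′))

Digon : ∀ {n} → Digraph n → Fin n → Fin n → Set
Digon D u v = Arc D u v × Arc D v u

digon? : ∀ {n} (D : Digraph n) u v → Dec (Digon D u v)
digon? D u v = arc? D u v ×-dec arc? D v u

digons : ∀ {n} → Digraph n → Fin n → ℕ
digons {n} D u = ∑[ v < n ] χ (digon? D u v)

arc⇒≢ : ∀ {n} (D : Digraph n) {u v} → Arc D u v → u ≢ v
arc⇒≢ D {u} u→u refl = loopless D u u→u

module _ {n} {D : Digraph n} where

  digon-cycle : ∀ {u v} → Digon D u v → Cycle D
  digon-cycle {u} {v} (u→v , v→u) = record
    { cverts  = u List⁺.∷ v ∷ []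
    ; long    = s≤s (s≤s z≤n)
    ; linked  = u→v Linked.∷ Linked.[-]
    ; closing = v→u
    ; unique  = (arc⇒≢ D u→v ∷ []) AllPairs.∷ ([] AllPairs.∷ AllPairs.[])
    }

  digon-family : ∀ u → CFamily D (digons D u)
  digon-family u with enumerate (digon? D u)
  ... | partner , digon-with-partner , partner-injective = u , C , (λ _ → here refl) , disjoint
    where
    C : Fin (digons D u) → Cycle D
    C i = digon-cycle (digon-with-partner i)
    on-C⇒partner : ∀ i {x} → x ≢ u → x ∈C C i → x ≡ partner i
    on-C⇒partner i x≢u (here x≡u)         = ⊥-elim (x≢u x≡u)
    on-C⇒partner i x≢u (there (here x≡v)) = x≡v
    disjoint : ∀ i j x → x ≢ u → x ∈C C i → x ∈C C j → i ≡ j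
    disjoint i j x x≢u x∈Ci x∈Cj =
      partner-injective (trans (sym (on-C⇒partner i x≢u x∈Ci)) (on-C⇒partner j x≢u x∈Cj))

  sum-digons≤c : ∀ {k} → IsC D k → ∑[ u < n ] digons D u ≤ n * k
  sum-digons≤c {k} (_ , maximal) =
    ≤-trans (sum-mono-≤ (λ u → maximal (digons D u) (digon-family u))) (≤-reflexive (sum-const n k))

∈⋃-map : ∀ {a n} {A : Set a} {f : A → Subset n} {ys y x} → y ∈ˡ ys → x ∈ f y →
         x ∈ ⋃ (map f ys)
∈⋃-map (here refl)  x∈fy = x∈p∪q⁺ (inj₁ x∈fy)
∈⋃-map (there y∈ys) x∈fy = x∈p∪q⁺ (inj₂ (∈⋃-map y∈ys x∈fy))

module Decomposition {n} {D : Digraph n} (T : ArborealDecomposition D) where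

  open Arborescence (R T) (r₀ T) (arbo T) using (reachable-antisym)

  home : Fin n → Fin (m T)
  home x = proj₁ (W-cov T x)

  ∈W-home : ∀ x → x ∈ W T (home x)
  ∈W-home x = proj₂ (W-cov T x)

  W⊆bag : ∀ {t x} → x ∈ W T t → x ∈ bag T t
  W⊆bag x∈W = x∈p∪q⁺ (inj₁ x∈W)

  X⊆bag : ∀ {s t x} → Arc (R T) s t → x ∈ X T s t → x ∈ bag T t
  X⊆bag {s} {t} {x} s→t x∈X = x∈p∪q⁺ (inj₂ (∈⋃-map (∈-allFin s) (x∈p∪q⁺ (inj₁ x∈X-if))))
    where
    x∈X-if : x ∈ (if does (t ∈? out (R T) s) then X T s t else Subset.⊥)
    x∈X-if with t ∈? out (R T) s
    ... | yes _     = x∈X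
    ... | no  ¬s→t = ⊥-elim (¬s→t s→t)

  digon-leaving-bag-descends : ∀ {u v} → Digon D u v → v ∉ bag T (home u) →
                               Reachable (R T) (home u) (home v)
  digon-leaving-bag-descends {u} {v} (u→v , v→u) v∉bag with home u ≟ r₀ T
  ... | yes hu≡r₀ = subst (λ t → Reachable (R T) t (home v)) (sym hu≡r₀) (proj₁ (arbo T) (home v))
  ... | no  hu≢r₀ =
    -- The part of R below the arc s → home u is X T s (home u)-normal, and the walk
    -- u → v → u avoids X T s (home u) ⊆ bag T (home u).
    let (s , s→hu)               = incoming-arc (proj₁ (arbo T) (home u)) (hu≢r₀ ∘ sym)
        (below-avoids-X , closed) = normal T s (home u) s→hu
        u-below                  = home u , stop , ∈W-home u
        u∉X                      = below-avoids-X u u-below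
        walk-avoids-X            = u∉X ∷ v∉bag ∘ X⊆bag s→hu ∷ u∉X ∷ []
        (t , hu→t , v∈Wt)        = All.head (All.tail (closed u u (step u→v (step v→u stop))
                                                             walk-avoids-X u-below u-below))
    in subst (Reachable (R T) (home u)) (W-disj T t (home v) v v∈Wt (∈W-home v)) hu→t

  digon-in-bag : ∀ {u v} → Digon D u v → v ∈ bag T (home u) ⊎ u ∈ bag T (home v)
  digon-in-bag {u} {v} (u→v , v→u) with v ∈? bag T (home u) | u ∈? bag T (home v)
  ... | yes v∈ | _      = inj₁ v∈
  ... | no  _  | yes u∈ = inj₂ u∈
  ... | no  v∉ | no  u∉ = ⊥-elim (v∉ (subst (λ t → v ∈ bag T t) (sym hu≡hv) (W⊆bag (∈W-home v))))
    where
    hu≡hv : home u ≡ home v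
    hu≡hv = reachable-antisym (digon-leaving-bag-descends (u→v , v→u) v∉)
                              (digon-leaving-bag-descends (v→u , u→v) u∉)

  co-bagged : Fin n → Fin n → ℕ
  co-bagged u v = χ (v ∈? bag T (home u) - u)

  sum-co-bagged≤width : ∀ {w} → WidthAtMost T w → ∀ u → ∑[ v < n ] co-bagged u v ≤ w
  sum-co-bagged≤width {w} width≤w u = ≤-pred (begin-strict
    ∑[ v < n ] co-bagged u v  ≡⟨ ∣p∣≡sum (bag T (home u) - u) ⟨
    ∣ bag T (home u) - u ∣    <⟨ x∈p⇒∣p-x∣<∣p∣ (W⊆bag (∈W-home u)) ⟩
    ∣ bag T (home u) ∣        ≤⟨ width≤w (home u) ⟩
    suc w                     ∎)
    where open ≤-Reasoning

  co-bagged-one : ∀ {u v} → v ∈ bag T (home u) → Arc D v u → co-bagged u v ≡ 1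
  co-bagged-one {u} {v} v∈ v→u = χ-yes (v ∈? bag T (home u) - u) (x∈p∧x≢y⇒x∈p-y v∈ (arc⇒≢ D v→u))

  digon⇒co-bagged : ∀ {u v} → Digon D u v → 1 ≤ co-bagged u v + co-bagged v u
  digon⇒co-bagged (u→v , v→u) with digon-in-bag (u→v , v→u)
  ... | inj₁ v∈ = ≤-trans (≤-reflexive (sym (co-bagged-one v∈ v→u))) (m≤m+n _ _)
  ... | inj₂ u∈ = ≤-trans (≤-reflexive (sym (co-bagged-one u∈ u→v))) (m≤n+m _ _)

  sum-digons≤width : ∀ {w} → WidthAtMost T w → ∑[ u < n ] digons D u ≤ n * (2 * w)
  sum-digons≤width {w} width≤w = begin
    ∑[ u < n ] digons D u
      ≤⟨ sum-mono-≤ (λ u → sum-mono-≤ (λ v → χ-≤ (digon? D u v) digon⇒co-bagged)) ⟩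
    ∑[ u < n ] ∑[ v < n ] (co-bagged u v + co-bagged v u)
      ≡⟨ sum-cong-≗ (λ u → ∑-distrib-+ (co-bagged u) (λ v → co-bagged v u)) ⟩
    ∑[ u < n ] (∑[ v < n ] co-bagged u v + ∑[ v < n ] co-bagged v u)
      ≡⟨ ∑-distrib-+ (λ u → ∑[ v < n ] co-bagged u v) (λ u → ∑[ v < n ] co-bagged v u) ⟩
    S + ∑[ u < n ] ∑[ v < n ] co-bagged v u
      ≡⟨ cong (S +_) (∑-comm (λ u v → co-bagged v u)) ⟩
    S + S
      ≤⟨ +-mono-≤ S≤n*w S≤n*w ⟩
    n * w + n * w
      ≡⟨ cong (λ w′ → n * w + n * w′) (+-identityʳ w) ⟨
    n * w + n * (w + 0)
      ≡⟨ *-distribˡ-+ n w (w + 0) ⟨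
    n * (2 * w) ∎
    where
    open ≤-Reasoning
    S : ℕ
    S = ∑[ u < n ] ∑[ v < n ] co-bagged u v
    S≤n*w : S ≤ n * w
    S≤n*w = ≤-trans (sum-mono-≤ (sum-co-bagged≤width width≤w)) (≤-reflexive (sum-const n w))

module _ {n} (D : Digraph n) where

  private
    a : Fin n → Fin n → ℕ
    a = adjacency D

  arc-pair≤1+digon : ∀ i j → a i j + a j i ≤ 1 + χ (digon? D i j)
  arc-pair≤1+digon i j with arc? D i j | arc? D j i
  ... | yes _ | yes _ = ≤-refl
  ... | yes _ | no  _ = ≤-refl
  ... | no  _ | yes _ = ≤-refl
  ... | no  _ | no  _ = z≤n

  twice-arcs≡ : 2 * arcs D ≡ ∑[ i < n ] ∑[ j < n ] (a i j + a j i)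
  twice-arcs≡ = begin
    2 * arcs D                                                ≡⟨ cong (arcs D +_) (+-identityʳ (arcs D)) ⟩
    arcs D + arcs D                                           ≡⟨ cong₂ _+_ (arcs≡sum-adjacency D) (trans (arcs≡sum-adjacency D) (∑-comm a)) ⟩
    ∑[ i < n ] ∑[ j < n ] a i j + ∑[ i < n ] ∑[ j < n ] a j i ≡⟨ ∑-distrib-+ (λ i → ∑[ j < n ] a i j) (λ i → ∑[ j < n ] a j i) ⟨
    ∑[ i < n ] (∑[ j < n ] a i j + ∑[ j < n ] a j i)         ≡⟨ sum-cong-≗ (λ i → ∑-distrib-+ (a i) (λ j → a j i)) ⟨
    ∑[ i < n ] ∑[ j < n ] (a i j + a j i)                     ∎
    where open ≡-Reasoning

  arc-row<n+digons : ∀ i → ∑[ j < n ] (a i j + a j i) < n + digons D i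
  arc-row<n+digons i = begin-strict
    ∑[ j < n ] (a i j + a j i)            <⟨ sum-mono-< (arc-pair≤1+digon i) i no-loop ⟩
    ∑[ j < n ] (1 + χ (digon? D i j))     ≡⟨ ∑-distrib-+ (λ _ → 1) (λ j → χ (digon? D i j)) ⟩
    ∑[ j < n ] 1 + digons D i             ≡⟨ cong (_+ digons D i) (trans (sum-const n 1) (*-identityʳ n)) ⟩
    n + digons D i                        ∎
    where
    open ≤-Reasoning
    no-loop : a i i + a i i < 1 + χ (digon? D i i)
    no-loop rewrite χ-no (arc? D i i) (loopless D i) = s≤s z≤n

twice-arcs< : ∀ {n} (D : Digraph (suc n)) → 2 * arcs D < suc n * suc n + ∑[ i < suc n ] digons D i
twice-arcs< {n} D = begin-strict
  2 * arcs D
    ≡⟨ twice-arcs≡ D ⟩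
  ∑[ i < N ] ∑[ j < N ] (adjacency D i j + adjacency D j i)
    <⟨ sum-mono-< (<⇒≤ ∘ arc-row<n+digons D) zero (arc-row<n+digons D zero) ⟩
  ∑[ i < N ] (N + digons D i)
    ≡⟨ ∑-distrib-+ (λ _ → N) (digons D) ⟩
  ∑[ i < N ] N + ∑[ i < N ] digons D i
    ≡⟨ cong (_+ ∑[ i < N ] digons D i) (sum-const N N) ⟩
  N * N + ∑[ i < N ] digons D i ∎
  where
  open ≤-Reasoning
  N : ℕ
  N = suc n

mainTheorem10 : ∀ n (D : Digraph (suc n)) (k w : ℕ) → IsC D k → IsDtw D w →
    2 * arcs D < suc n * (suc n + k ⊓ (2 * w))
mainTheorem10 n D k w c≡k ((T , width≤w) , _) = begin-strict
  2 * arcs D                      <⟨ twice-arcs< D ⟩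
  N * N + ∑[ i < N ] digons D i   ≤⟨ +-monoʳ-≤ (N * N) (⊓-glb via-c via-dtw) ⟩
  N * N + (N * k) ⊓ (N * (2 * w)) ≡⟨ cong (N * N +_) (*-distribˡ-⊓ N k (2 * w)) ⟨
  N * N + N * (k ⊓ (2 * w))       ≡⟨ *-distribˡ-+ N N (k ⊓ (2 * w)) ⟨
  N * (N + k ⊓ (2 * w))           ∎
  where
  open ≤-Reasoning
  N : ℕ
  N = suc n
  via-c : ∑[ i < N ] digons D i ≤ N * k
  via-c = sum-digons≤c c≡k
  via-dtw : ∑[ i < N ] digons D i ≤ N * (2 * w)
  via-dtw = Decomposition.sum-digons≤width T width≤w
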